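{- Let $\pi$ be a signed permutation and, for each cycle $C$ of $BG(\pi)$, let $C^{ -1}$ denote the corresponding cycle of $BG(\pi^{ -1})$. Then two cycles $C$ and $D$ of $BG(\pi)$ belong to the same component of $BG(\pi)$ if and only if $C^{ -1}$ and $D^{ -1}$ belong to the same component of $BG(\pi^{ -1})$; equivalently, for every component $\mathscr C$ of $BG(\pi)$, the set $\{C^{ -1}: C\in\mathscr C\}$ is a component of $BG(\pi^{ -1})$.
   Context: A signed permutation of size $n$ is a sequence $\pi=\langle\pi_1\ \cdots\ \pi_n\rangle$ of nonzero integers such that $(|\pi_1|,\ldots,|\pi_n|)$ is a permutation of $\{1,\ldots,n\}$; its inverse $\pi^{ -1}$ is the signed permutation with $\pi^{ -1}_{|\pi_i|}=\operatorname{sign}(\pi_i)\, i$ for all $i$. Breakpoint graph: let $\pi'=(\pi'_0,\ldots,\pi'_{2n+1})$ with $\pi'_0=0$, $\pi'_{2n+1}=2n+1$ and, for $1\le i\le n$, $(\pi'_{2i-1},\pi'_{2i})=(2\pi_i-1,2\pi_i)$ if $\pi_i>0$ and $(2|\pi_i|,2|\pi_i|-1)$ if $\pi_i<0$. $BG(\pi)$ has one vertex per position $p\in\{0,\ldots,2n+1\}$ (labelled $\pi'_p$); black edges join positions $2i$ and $2i+1$ ($0\le i\le n$); grey edges join the vertices labelled $2k$ and $2k+1$ ($0\le k\le n$). $BG(\pi)$ decomposes uniquely into alternating (black/grey) cycles. Correspondence: one has $(\pi^{ -1})'_{\pi'_p}=p$ for all $p$. Identify the vertex at position $p$ of $BG(\pi)$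 with the vertex at position $\pi'_p$ of $BG(\pi^{ -1})$; under this identification black edges of $BG(\pi)$ become grey edges of $BG(\pi^{ -1})$ and grey edges become black edges, so each cycle $C$ of $BG(\pi)$ is mapped onto a cycle $C^{ -1}$ of $BG(\pi^{ -1})$. The support of a grey edge joining positions $i<j$ is the interval $[i,j]$. Two distinct grey edges interleave if their supports overlap but neither contains the other; two cycles interleave if some grey edge of one interleaves with some grey edge of the other. A component of $BG(\pi)$ is a connected component of the graph whose vertices are the cycles of $BG(\pi)$, two cycles being adjacent when they interleave. -}

module Defs where

open import Data.Nat using (ℕ; zero; suc; _+_; _*_; _<_; _≤_; _<?_; _≡ᵇ_)
open import Data.Nat.DivMod using (_/_; _%_)
open import Data.Fin using (Fin; toℕ; fromℕ<)
open import Data.Fin.Permutation using (Permutation′; _⟨$⟩ʳ_; _⟨$⟩ˡ_; flip)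
open import Data.Bool using (Bool; true; false; if_then_else_)
open import Data.Product using (Σ; ∃; _×_; _,_)
open import Data.Sum using (_⊎_)
open import Relation.Nullary using (¬_; yes; no)
open import Relation.Binary.PropositionalEquality using (_≡_; _≢_)
open import Relation.Binary.Construct.Closure.ReflexiveTransitive using (Star)

-- Signed permutations of size n.
-- π_i = sign_i · |π_i|, where |π_i| = 1 + toℕ (perm ⟨$⟩ʳ i)  (indices are
-- 0-based: Fin n index i stands for position i+1), and neg i = true
-- iff π_i < 0.  Every sequence of nonzero integers whose absolute values
-- form a permutation of {1..n} arises exactly once this way.

record SignedPerm (n : ℕ) : Set where
  constructor signedPerm
  field
    perm : Permutation′ n
    neg  : Fin n → Bool
open SignedPerm public

-- Inverse: π⁻¹_{|π_i|} = sign(π_i) · i, i.e. the underlying permutation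
-- is inverted and the sign at index j = |π_i| is the sign of π_i.
inverse : ∀ {n} → SignedPerm n → SignedPerm n
inverse π = signedPerm (flip (perm π)) (λ j → neg π (perm π ⟨$⟩ˡ j))

-- The extended sequence π' = (π'_0, …, π'_{2n+1}), as a function of the
-- position p ∈ ℕ (only positions p < 2n+2 are meaningful).
-- For the 0-based index i (paper's index i+1), positions 2i+1 and 2i+2
-- carry (2|π|-1, 2|π|) if positive and (2|π|, 2|π|-1) if negative.
-- With a = |π| - 1 these are 2a+1 and 2a+2.

entryLabel : ∀ {n} → SignedPerm n → Fin n → Bool → ℕ
entryLabel π i first with toℕ (perm π ⟨$⟩ʳ i)
... | a = if neg π i
            then (if first then 2 * a + 2 else 2 * a + 1)
            else (if first then 2 * a + 1 else 2 * a + 2)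

prime : ∀ {n} → SignedPerm n → ℕ → ℕ
prime {n} π zero = 0
prime {n} π (suc p) with p / 2 <? n
... | yes i<n = entryLabel π (fromℕ< i<n) (p % 2 ≡ᵇ 0)
... | no _    = 2 * n + 1

-- Breakpoint graph BG(π); vertices are the positions p < 2n+2.

Black : ∀ {n} → SignedPerm n → ℕ → ℕ → Set
Black {n} π p q = Σ ℕ λ i → i ≤ n × p ≡ 2 * i × q ≡ 2 * i + 1

Grey : ∀ {n} → SignedPerm n → ℕ → ℕ → Set
Grey {n} π i j =
  i < j × j < 2 * n + 2 ×
  (Σ ℕ λ k → k ≤ n ×
     ((prime π i ≡ 2 * k × prime π j ≡ 2 * k + 1)
      ⊎ (prime π i ≡ 2 * k + 1 × prime π j ≡ 2 * k)))

Adjacent : ∀ {n} → SignedPerm n → ℕ → ℕ → Set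
Adjacent π p q = Black π p q ⊎ Black π q p ⊎ Grey π p q ⊎ Grey π q p

-- p and q lie on the same alternating cycle of BG(π)
-- (the alternating cycles are exactly the connected components of BG(π),
-- every vertex having one black and one grey edge)
SameCycle : ∀ {n} → SignedPerm n → ℕ → ℕ → Set
SameCycle π = Star (Adjacent π)

Interleave : ℕ → ℕ → ℕ → ℕ → Set
Interleave i j i' j' =
  ¬ (i ≡ i' × j ≡ j') ×
  (i' ≤ j × i ≤ j') ×
  ¬ (i ≤ i' × j' ≤ j) ×
  ¬ (i' ≤ i × j ≤ j')

CyclesInterleave : ∀ {n} → SignedPerm n → ℕ → ℕ → Set
CyclesInterleave π p q =
  Σ ℕ λ i → Σ ℕ λ j → Σ ℕ λ i' → Σ ℕ λ j' →
    Grey π i j × Grey π i' j' ×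
    SameCycle π p i × SameCycle π q i' ×
    Interleave i j i' j'

SameComponent : ∀ {n} → SignedPerm n → ℕ → ℕ → Set
SameComponent π = Star (λ p q → SameCycle π p q ⊎ CyclesInterleave π p q)

module Submission where

-- The map σ : p ↦ π'_p sends positions of BG(π) to positions of BG(π⁻¹),
-- black edges to grey edges and grey edges to black edges, hence cycles to
-- cycles.  The difficulty is interleaving: two interleaving grey edges of
-- BG(π) become two black edges of BG(π⁻¹) which must be shown to lie in one
-- component.  We work with an abstract relabelling σ (a bijection of the
-- positions fixing both ends and commuting with the swap of the two slots of
-- an entry).  For a component with extent [lo , hi] we show that the extent
-- is a union of components (a foreign position inside it is enclosed by a
-- grey edge of the component) and that its labels form an interval.  So if
-- the label intervals of two black edges interleave, each edge lies in the
-- extent of the other's component, and distinct components would enclose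
-- each other, which is absurd.  Transferring along σ and back along its
-- inverse gives the theorem.

open import Defs
open import Data.Nat using (ℕ; zero; suc; _+_; _*_; _<_; _≤_; _<?_; _≟_; _≤?_; z≤n; s≤s; pred; _≡ᵇ_)
open import Data.Nat.Properties
open import Data.Nat.DivMod using (_/_; _%_; m*n/n≡m; m*n%n≡0; +-distrib-/; %-distribˡ-+)
open import Data.Fin using (Fin; toℕ; fromℕ<)
open import Data.Fin.Properties using (toℕ<n; toℕ-fromℕ<; fromℕ<-toℕ; fromℕ<-cong)
open import Data.Fin.Permutation using (Permutation′; _⟨$⟩ʳ_; _⟨$⟩ˡ_; flip; inverseˡ; inverseʳ)
open import Data.Bool using (Bool; true; false; if_then_else_; not; _xor_)
open import Data.Bool.Properties using (not-distribˡ-xor; xor-assoc; xor-same; xor-identityʳ)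
open import Data.Product using (Σ; _×_; _,_; proj₁; proj₂)
open import Data.Sum using (_⊎_; inj₁; inj₂)
open import Data.Empty using (⊥; ⊥-elim)
open import Function using (_∘_)
open import Function.Bundles using (_⇔_; mk⇔)
open import Relation.Nullary using (¬_; yes; no; Dec)
open import Relation.Nullary.Decidable using (_×-dec_; _⊎-dec_; ¬?)
open import Relation.Binary.Definitions using (tri<; tri≈; tri>)
open import Relation.Binary.PropositionalEquality
open import Relation.Binary.Construct.Closure.ReflexiveTransitive using (Star; ε; _◅_; _◅◅_; gmap; reverse)

-- The black-edge partner of a position: 2k ↔ 2k+1.
twin : ℕ → ℕ
twin 0 = 1
twin 1 = 0
twin (suc (suc k)) = suc (suc (twin k))

-- The other position of the same entry: 2i+1 ↔ 2i+2 (meaningful for p ≥ 1).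
entryTwin : ℕ → ℕ
entryTwin p = suc (twin (pred p))

twin-involutive : ∀ x → twin (twin x) ≡ x
twin-involutive 0 = refl
twin-involutive 1 = refl
twin-involutive (suc (suc k)) = cong (suc ∘ suc) (twin-involutive k)

twin-cases : ∀ x → twin x ≡ suc x ⊎ suc (twin x) ≡ x
twin-cases 0 = inj₁ refl
twin-cases 1 = inj₂ refl
twin-cases (suc (suc k)) with twin-cases k
... | inj₁ e = inj₁ (cong (suc ∘ suc) e)
... | inj₂ e = inj₂ (cong (suc ∘ suc) e)

twin-even : ∀ k → twin (2 * k) ≡ 2 * k + 1
twin-even zero = refl
twin-even (suc k) = begin
  twin (2 * suc k)         ≡⟨ cong twin (*-suc 2 k) ⟩
  suc (suc (twin (2 * k))) ≡⟨ cong (suc ∘ suc) (twin-even k) ⟩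
  suc (suc (2 * k + 1))    ≡⟨ cong (_+ 1) (sym (*-suc 2 k)) ⟩
  2 * suc k + 1            ∎
  where open ≡-Reasoning

twin-odd : ∀ k → twin (2 * k + 1) ≡ 2 * k
twin-odd k = begin
  twin (2 * k + 1)        ≡⟨ cong twin (sym (twin-even k)) ⟩
  twin (twin (2 * k))     ≡⟨ twin-involutive (2 * k) ⟩
  2 * k                   ∎
  where open ≡-Reasoning

parity : ∀ x → Σ ℕ λ k → x ≡ 2 * k ⊎ x ≡ 2 * k + 1
parity 0 = 0 , inj₁ refl
parity 1 = 0 , inj₂ refl
parity (suc (suc x)) with parity x
... | k , inj₁ e = suc k , inj₁ (trans (cong (suc ∘ suc) e) (sym (*-suc 2 k)))
... | k , inj₂ e = suc k , inj₂ (trans (cong (suc ∘ suc) e) (cong (_+ 1) (sym (*-suc 2 k))))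

suc≢ : ∀ x → suc x ≢ x
suc≢ zero ()
suc≢ (suc x) e = suc≢ x (suc-injective e)

twin-irreflexive : ∀ x → twin x ≢ x
twin-irreflexive x e with twin-cases x
... | inj₁ e' = suc≢ x (trans (sym e') e)
... | inj₂ e' = suc≢ x (trans (cong suc (sym e)) e')

entryTwin-cases : ∀ y → 1 ≤ y → entryTwin y ≡ suc y ⊎ suc (entryTwin y) ≡ y
entryTwin-cases (suc y) _ with twin-cases y
... | inj₁ e = inj₁ (cong suc e)
... | inj₂ e = inj₂ (cong suc e)

2k+1≡suc : ∀ k → 2 * k + 1 ≡ suc (2 * k)
2k+1≡suc k = +-comm (2 * k) 1

size≡ : ∀ n → 2 * n + 2 ≡ 2 * suc n
size≡ n = trans (+-comm (2 * n) 2) (sym (*-suc 2 n))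

suc[2k+1]≡ : ∀ k → suc (2 * k + 1) ≡ 2 * suc k
suc[2k+1]≡ k = trans (cong suc (2k+1≡suc k)) (sym (*-suc 2 k))

last<size : ∀ n → 2 * n + 1 < 2 * n + 2
last<size n = subst (2 * n + 1 <_) (sym (+-suc (2 * n) 1)) ≤-refl

2k<2k+1 : ∀ k → 2 * k < 2 * k + 1
2k<2k+1 k = subst (2 * k <_) (sym (2k+1≡suc k)) ≤-refl

half-bound : ∀ k n → 2 * k < 2 * n + 2 → k ≤ n
half-bound k n p with k ≤? n
... | yes q = q
... | no q = ⊥-elim (<⇒≱ p (subst (_≤ 2 * k) (sym (size≡ n)) (*-monoʳ-≤ 2 (≰⇒> q))))

odd-bound : ∀ k n → k ≤ n → 2 * k + 1 ≤ 2 * n + 1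
odd-bound k n p = +-monoˡ-≤ 1 (*-monoʳ-≤ 2 p)

below-last : ∀ n x → x < 2 * n + 2 → x ≢ 2 * n + 1 → x ≤ 2 * n
below-last n x p q =
  ≤-pred (subst (x <_) (2k+1≡suc n) (≤∧≢⇒< (≤-pred (subst (x <_) (+-suc (2 * n) 1) p)) q))

twin-bound : ∀ n x → x < 2 * n + 2 → twin x < 2 * n + 2
twin-bound n x x< with parity x
... | k , inj₁ refl = subst (_< 2 * n + 2) (sym (twin-even k))
                        (≤-<-trans (odd-bound k n (half-bound k n x<)) (last<size n))
... | k , inj₂ refl = subst (_< 2 * n + 2) (sym (twin-odd k)) (<-trans (2k<2k+1 k) x<)

entryTwin-bound : ∀ n p → 1 ≤ p → p ≤ 2 * n → entryTwin p < 2 * n + 2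
entryTwin-bound n p 1≤p p≤ with entryTwin-cases p 1≤p
... | inj₁ e = subst (_< 2 * n + 2) (sym e)
                 (≤-<-trans (subst (suc p ≤_) (sym (2k+1≡suc n)) (s≤s p≤)) (last<size n))
... | inj₂ e = <-trans (subst (entryTwin p <_) e ≤-refl)
                 (≤-<-trans p≤ (<-trans (2k<2k+1 n) (last<size n)))

next-position : ∀ n b → suc b < 2 * n + 2 →
  suc b ≡ twin b ⊎ (1 ≤ b × b ≤ 2 * n × suc b ≡ entryTwin b)
next-position n b sb< with parity b
... | k , inj₁ refl = inj₁ (trans (sym (2k+1≡suc k)) (sym (twin-even k)))
... | k , inj₂ refl = inj₂ (1≤ , b≤ , e)
  where
  1≤ : 1 ≤ 2 * k + 1
  1≤ = subst (1 ≤_) (sym (2k+1≡suc k)) (s≤s z≤n)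
  b≤ : 2 * k + 1 ≤ 2 * n
  b≤ = ≤-pred (subst (suc (2 * k + 1) ≤_) (2k+1≡suc n)
         (≤-pred (subst (suc (suc (2 * k + 1)) ≤_) (+-suc (2 * n) 1) sb<)))
  e : suc (2 * k + 1) ≡ entryTwin (2 * k + 1)
  e = trans (cong suc (sym (twin-even k))) (cong (suc ∘ twin ∘ pred) (sym (2k+1≡suc k)))

previous-position : ∀ n b → suc b < 2 * n + 2 →
  b ≡ twin (suc b) ⊎ (1 ≤ suc b × suc b ≤ 2 * n × b ≡ entryTwin (suc b))
previous-position n b sb< with parity b
... | k , inj₁ refl = inj₁ (sym (trans (cong twin (sym (2k+1≡suc k))) (twin-odd k)))
... | k , inj₂ refl = inj₂ (s≤s z≤n , sb≤ , e)
  where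
  e : 2 * k + 1 ≡ entryTwin (suc (2 * k + 1))
  e = trans (2k+1≡suc k) (cong suc (sym (twin-odd k)))
  sb≤ : suc (2 * k + 1) ≤ 2 * n
  sb≤ = below-last n (suc (2 * k + 1)) sb< λ eq →
          even≢odd (suc k) n (trans (sym (suc[2k+1]≡ k)) (trans eq (2k+1≡suc n)))

interleave-left : ∀ {s t c d} → s < c → c < t → t < d → Interleave s t c d
interleave-left s<c c<t t<d =
  (λ { (e , _) → <⇒≢ s<c e }) ,
  (<⇒≤ c<t , <⇒≤ (<-trans s<c (<-trans c<t t<d))) ,
  (λ { (_ , d≤t) → <⇒≱ t<d d≤t }) ,
  (λ { (c≤s , _) → <⇒≱ s<c c≤s })

interleave-right : ∀ {s t c d} → c < s → s < d → d < t → Interleave s t c d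
interleave-right c<s s<d d<t =
  (λ { (e , _) → <⇒≢ c<s (sym e) }) ,
  (<⇒≤ (<-trans c<s (<-trans s<d d<t)) , <⇒≤ s<d) ,
  (λ { (s≤c , _) → <⇒≱ c<s s≤c }) ,
  (λ { (_ , t≤d) → <⇒≱ d<t t≤d })

interleave-sym : ∀ {a b c d} → Interleave a b c d → Interleave c d a b
interleave-sym (≢ , (p , q) , ⊈ , ⊉) = (λ { (e₁ , e₂) → ≢ (sym e₁ , sym e₂) }) , (q , p) , ⊉ , ⊈

interleave-cong : ∀ {a b c d a' b' c' d'} → a ≡ a' → b ≡ b' → c ≡ c' → d ≡ d' →
  Interleave a b c d → Interleave a' b' c' d'
interleave-cong refl refl refl refl il = il

interleave-cases : ∀ {a b a' b'} → Interleave a b a' b' → a ≢ a' → a' ≢ b → a ≢ b' →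
  (a < a' × a' < b × b < b') ⊎ (a' < a × a < b' × b' < b)
interleave-cases {a} {b} {a'} {b'} (_ , (a'≤b , a≤b') , ⊈ , ⊉) a≢a' a'≢b a≢b' with <-cmp a a'
... | tri≈ _ e _ = ⊥-elim (a≢a' e)
... | tri< a<a' _ _ with b' ≤? b
...   | yes b'≤b = ⊥-elim (⊈ (<⇒≤ a<a' , b'≤b))
...   | no b'≰b = inj₁ (a<a' , ≤∧≢⇒< a'≤b a'≢b , ≰⇒> b'≰b)
interleave-cases {a} {b} {a'} {b'} (_ , (a'≤b , a≤b') , ⊈ , ⊉) a≢a' a'≢b a≢b' | tri> _ _ a'<a with b ≤? b'
...   | yes b≤b' = ⊥-elim (⊉ (<⇒≤ a'<a , b≤b'))
...   | no b≰b' = inj₂ (a'<a , ≤∧≢⇒< a≤b' a≢b' , ≰⇒> b≰b')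

pigeonhole₃ : ∀ {a b c lo hi : ℕ} → (a ≡ lo ⊎ a ≡ hi) → (b ≡ lo ⊎ b ≡ hi) → (c ≡ lo ⊎ c ≡ hi) →
  a ≡ b ⊎ a ≡ c ⊎ b ≡ c
pigeonhole₃ (inj₁ x) (inj₁ y) _ = inj₁ (trans x (sym y))
pigeonhole₃ (inj₂ x) (inj₂ y) _ = inj₁ (trans x (sym y))
pigeonhole₃ (inj₁ x) (inj₂ y) (inj₁ z) = inj₂ (inj₁ (trans x (sym z)))
pigeonhole₃ (inj₁ x) (inj₂ y) (inj₂ z) = inj₂ (inj₂ (trans y (sym z)))
pigeonhole₃ (inj₂ x) (inj₁ y) (inj₁ z) = inj₂ (inj₂ (trans y (sym z)))
pigeonhole₃ (inj₂ x) (inj₁ y) (inj₂ z) = inj₂ (inj₁ (trans x (sym z)))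

boundedΣ? : {P : ℕ → Set} → (∀ i → Dec (P i)) → (B : ℕ) → (∀ {i} → P i → i < B) → Dec (Σ ℕ P)
boundedΣ? P? B bound with anyUpTo? P? B
... | yes (i , _ , p) = yes (i , p)
... | no none = no λ { (i , p) → none (i , bound p , p) }

module Search {P : ℕ → Set} (P? : ∀ i → Dec (P i)) where

  searchBelow : ∀ k → (∀ v → v < k → ¬ P v) ⊎ (Σ ℕ λ m → P m × (∀ v → v < m → ¬ P v))
  searchBelow zero = inj₁ λ v ()
  searchBelow (suc k) with searchBelow k
  ... | inj₂ found = inj₂ found
  ... | inj₁ none with P? k
  ...   | yes pk = inj₂ (k , pk , none)
  ...   | no ¬pk = inj₁ λ v v<sk → below v (m≤n⇒m<n∨m≡n (≤-pred v<sk))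
    where
    below : ∀ v → v < k ⊎ v ≡ k → ¬ P v
    below v (inj₁ v<k) = none v v<k
    below v (inj₂ refl) = ¬pk

  least : ∀ x → P x → Σ ℕ λ m → P m × (∀ v → v < m → ¬ P v)
  least x px with searchBelow (suc x)
  ... | inj₁ none = ⊥-elim (none x ≤-refl px)
  ... | inj₂ found = found

  greatest : ∀ B x → P x → x < B → Σ ℕ λ m → P m × m < B × (∀ v → m < v → v < B → ¬ P v)
  greatest (suc B) x px x<sB with P? B
  ... | yes pB = B , pB , ≤-refl , λ v B<v v<sB _ → <⇒≱ B<v (≤-pred v<sB)
  ... | no ¬pB with m≤n⇒m<n∨m≡n (≤-pred x<sB)
  ...   | inj₂ refl = ⊥-elim (¬pB px)
  ...   | inj₁ x<B with greatest B x px x<B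
  ...     | m , pm , m<B , above = m , pm , m<n⇒m<1+n m<B , λ v m<v v<sB → beyond v m<v (m≤n⇒m<n∨m≡n (≤-pred v<sB))
    where
    beyond : ∀ v → m < v → v < B ⊎ v ≡ B → ¬ P v
    beyond v m<v (inj₁ v<B) = above v m<v v<B
    beyond v m<v (inj₂ refl) = ¬pB

  firstExit : ∀ a c → P a → ¬ P c → a < c → Σ ℕ λ b → a ≤ b × b < c × P b × ¬ P (suc b)
  firstExit a (suc c) pa ¬psc a<sc with P? c
  ... | yes pc = c , ≤-pred a<sc , ≤-refl , pc , ¬psc
  ... | no ¬pc with m≤n⇒m<n∨m≡n (≤-pred a<sc)
  ...   | inj₂ refl = ⊥-elim (¬pc pa)
  ...   | inj₁ a<c with firstExit a c pa ¬pc a<c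
  ...     | b , a≤b , b<c , pb , ¬psb = b , a≤b , m<n⇒m<1+n b<c , pb , ¬psb

firstEntry : ∀ {P : ℕ → Set} (P? : ∀ i → Dec (P i)) a c → ¬ P a → P c → a < c →
  Σ ℕ λ b → a ≤ b × b < c × ¬ P b × P (suc b)
firstEntry P? a c ¬pa pc a<c with Search.firstExit (¬? ∘ P?) a c ¬pa (λ ¬pc → ¬pc pc) a<c
... | b , a≤b , b<c , ¬pb , ¬¬psb with P? (suc b)
...   | yes psb = b , a≤b , b<c , ¬pb , psb
...   | no ¬psb = ⊥-elim (¬¬psb ¬psb)

module Reachability {R : ℕ → ℕ → Set} (R? : ∀ x y → Dec (R x y)) (N : ℕ)
  (step-bound : ∀ {x y} → R x y → y ≡ x ⊎ y < N) where

  -- x reaches y by a path all of whose intermediate vertices are below m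
  PathVia : ℕ → ℕ → ℕ → Set
  PathVia zero x y = x ≡ y ⊎ R x y
  PathVia (suc m) x y = PathVia m x y ⊎ (PathVia m x m × PathVia m m y)

  pathVia? : ∀ m x y → Dec (PathVia m x y)
  pathVia? zero x y = (x ≟ y) ⊎-dec R? x y
  pathVia? (suc m) x y = pathVia? m x y ⊎-dec (pathVia? m x m ×-dec pathVia? m m y)

  pathVia⇒star : ∀ m {x y} → PathVia m x y → Star R x y
  pathVia⇒star zero (inj₁ refl) = ε
  pathVia⇒star zero (inj₂ r) = r ◅ ε
  pathVia⇒star (suc m) (inj₁ path) = pathVia⇒star m path
  pathVia⇒star (suc m) (inj₂ (path₁ , path₂)) = pathVia⇒star m path₁ ◅◅ pathVia⇒star m path₂

  pathVia-refl : ∀ m {x} → PathVia m x x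
  pathVia-refl zero = inj₁ refl
  pathVia-refl (suc m) = inj₁ (pathVia-refl m)

  pathVia-step : ∀ m {x y} → R x y → PathVia m x y
  pathVia-step zero r = inj₂ r
  pathVia-step (suc m) r = inj₁ (pathVia-step m r)

  pathVia-endpoint : ∀ m {x y} → PathVia (suc m) x y → (x ≡ m ⊎ y ≡ m) → PathVia m x y
  pathVia-endpoint m (inj₁ path) _ = path
  pathVia-endpoint m (inj₂ (_ , path)) (inj₁ refl) = path
  pathVia-endpoint m (inj₂ (path , _)) (inj₂ refl) = path

  pathVia-trans : ∀ m {x y z} → z < m → PathVia m x z → PathVia m z y → PathVia m x y
  pathVia-trans (suc m) z<sm f g with m≤n⇒m<n∨m≡n (≤-pred z<sm)
  ... | inj₂ refl = inj₂ (pathVia-endpoint m f (inj₂ refl) , pathVia-endpoint m g (inj₁ refl))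
  ... | inj₁ z<m with f | g
  ... | inj₁ a | inj₁ b = inj₁ (pathVia-trans m z<m a b)
  ... | inj₁ a | inj₂ (b₁ , b₂) = inj₂ (pathVia-trans m z<m a b₁ , b₂)
  ... | inj₂ (a₁ , a₂) | inj₁ b = inj₂ (a₁ , pathVia-trans m z<m a₂ b)
  ... | inj₂ (a₁ , _) | inj₂ (_ , b₂) = inj₂ (a₁ , b₂)

  star⇒pathVia : ∀ {x y} → Star R x y → PathVia N x y
  star⇒pathVia ε = pathVia-refl N
  star⇒pathVia (r ◅ rs) with step-bound r
  ... | inj₁ refl = star⇒pathVia rs
  ... | inj₂ w<N = pathVia-trans N w<N (pathVia-step N r) (star⇒pathVia rs)

  reachable? : ∀ x y → Dec (Star R x y)
  reachable? x y with pathVia? N x y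
  ... | yes path = yes (pathVia⇒star N path)
  ... | no ¬path = no (¬path ∘ star⇒pathVia)

-- The breakpoint graph of an arbitrary labelling σ of the positions
-- 0 … 2n+1.  For σ = prime π these are literally the notions of Defs.

module Graph (n : ℕ) (σ : ℕ → ℕ) where

  BlackEdge : ℕ → ℕ → Set
  BlackEdge p q = Σ ℕ λ i → i ≤ n × p ≡ 2 * i × q ≡ 2 * i + 1

  GreyEdge : ℕ → ℕ → Set
  GreyEdge i j =
    i < j × j < 2 * n + 2 ×
    (Σ ℕ λ k → k ≤ n ×
      ((σ i ≡ 2 * k × σ j ≡ 2 * k + 1)
       ⊎ (σ i ≡ 2 * k + 1 × σ j ≡ 2 * k)))

  Adj : ℕ → ℕ → Set
  Adj p q = BlackEdge p q ⊎ BlackEdge q p ⊎ GreyEdge p q ⊎ GreyEdge q p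

  Cyc : ℕ → ℕ → Set
  Cyc = Star Adj

  Cross : ℕ → ℕ → Set
  Cross p q = Σ ℕ λ i → Σ ℕ λ j → Σ ℕ λ i' → Σ ℕ λ j' →
    GreyEdge i j × GreyEdge i' j' × Cyc p i × Cyc q i' × Interleave i j i' j'

  Step : ℕ → ℕ → Set
  Step p q = Cyc p q ⊎ Cross p q

  Comp : ℕ → ℕ → Set
  Comp = Star Step

-- Under σ, black edges of Graph n σ become grey edges of Graph n τ.

record Relabelling (n : ℕ) : Set where
  field
    σ τ         : ℕ → ℕ
    σ-bound     : ∀ p → p < 2 * n + 2 → σ p < 2 * n + 2
    τ-bound     : ∀ l → l < 2 * n + 2 → τ l < 2 * n + 2
    τ∘σ         : ∀ p → p < 2 * n + 2 → τ (σ p) ≡ p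
    σ∘τ         : ∀ l → l < 2 * n + 2 → σ (τ l) ≡ l
    σ-first     : σ 0 ≡ 0
    σ-last      : σ (2 * n + 1) ≡ 2 * n + 1
    σ-entryTwin : ∀ p → 1 ≤ p → p ≤ 2 * n → σ (entryTwin p) ≡ entryTwin (σ p)

-- The inverse τ enjoys the same properties, so the roles can be swapped.
module RelabellingProperties {n : ℕ} (R : Relabelling n) where
  open Relabelling R

  τ-first : τ 0 ≡ 0
  τ-first = trans (cong τ (sym σ-first)) (τ∘σ 0 (≤-<-trans z≤n (last<size n)))

  τ-last : τ (2 * n + 1) ≡ 2 * n + 1
  τ-last = trans (cong τ (sym σ-last)) (τ∘σ _ (last<size n))

  τ-entryTwin : ∀ l → 1 ≤ l → l ≤ 2 * n → τ (entryTwin l) ≡ entryTwin (τ l)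
  τ-entryTwin l 1≤l l≤ = begin
    τ (entryTwin l)        ≡⟨ cong (τ ∘ entryTwin) (sym (σ∘τ l l<)) ⟩
    τ (entryTwin (σ p))    ≡⟨ cong τ (sym (σ-entryTwin p 1≤p p≤)) ⟩
    τ (σ (entryTwin p))    ≡⟨ τ∘σ (entryTwin p) (entryTwin-bound n p 1≤p p≤) ⟩
    entryTwin p            ∎
    where
    open ≡-Reasoning
    l< : l < 2 * n + 2
    l< = ≤-<-trans l≤ (<-trans (2k<2k+1 n) (last<size n))
    p : ℕ
    p = τ l
    -- p is neither 0 nor 2n+1, since σ fixes those and l ∉ {0, 2n+1}
    1≤p : 1 ≤ p
    1≤p with p ≟ 0
    ... | no p≢0 = n≢0⇒n>0 p≢0
    ... | yes p≡0 = ⊥-elim (<⇒≱ 1≤l (≤-reflexive (trans (sym (σ∘τ l l<)) (trans (cong σ p≡0) σ-first))))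
    p≤ : p ≤ 2 * n
    p≤ = below-last n p (τ-bound l l<) λ p≡last → <⇒≱ (2k<2k+1 n)
           (subst (_≤ 2 * n) (trans (sym (σ∘τ l l<)) (trans (cong σ p≡last) σ-last)) l≤)

dual : ∀ {n} → Relabelling n → Relabelling n
dual R = record
  { σ = τ ; τ = σ ; σ-bound = τ-bound ; τ-bound = σ-bound ; τ∘σ = σ∘τ ; σ∘τ = τ∘σ
  ; σ-first = τ-first ; σ-last = τ-last ; σ-entryTwin = τ-entryTwin }
  where
  open Relabelling R
  open RelabellingProperties R

module Component {n : ℕ} (R : Relabelling n) where
  open Relabelling R
  open RelabellingProperties R using (τ-first)
  open Graph n σ

  N : ℕ
  N = 2 * n + 2

  σ-injective : ∀ {p q} → p < N → q < N → σ p ≡ σ q → p ≡ q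
  σ-injective {p} {q} p< q< e = trans (sym (τ∘σ p p<)) (trans (cong τ e) (τ∘σ q q<))

  τ-injective : ∀ {l m} → l < N → m < N → τ l ≡ τ m → l ≡ m
  τ-injective {l} {m} l< m< e = trans (sym (σ∘τ l l<)) (trans (cong σ e) (σ∘τ m m<))

  black-twin : ∀ {p q} → BlackEdge p q → q ≡ twin p
  black-twin (i , _ , refl , refl) = sym (twin-even i)

  black-suc : ∀ {p q} → BlackEdge p q → q ≡ suc p
  black-suc (i , _ , refl , refl) = 2k+1≡suc i

  black-bound : ∀ {p q} → BlackEdge p q → p < N × q < N
  black-bound (i , i≤n , refl , refl) = <-trans (2k<2k+1 i) q< , q<
    where q< = ≤-<-trans (odd-bound i n i≤n) (last<size n)

  grey-twin : ∀ {i j} → GreyEdge i j → σ j ≡ twin (σ i)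
  grey-twin (_ , _ , k , _ , inj₁ (e₁ , e₂)) = trans e₂ (trans (sym (twin-even k)) (cong twin (sym e₁)))
  grey-twin (_ , _ , k , _ , inj₂ (e₁ , e₂)) = trans e₂ (trans (sym (twin-odd k)) (cong twin (sym e₁)))

  grey-bound : ∀ {i j} → GreyEdge i j → i < N × j < N
  grey-bound (i<j , j<N , _) = <-trans i<j j<N , j<N

  adj-bound : ∀ {p q} → Adj p q → p < N × q < N
  adj-bound (inj₁ b) = black-bound b
  adj-bound (inj₂ (inj₁ b)) = proj₂ (black-bound b) , proj₁ (black-bound b)
  adj-bound (inj₂ (inj₂ (inj₁ g))) = grey-bound g
  adj-bound (inj₂ (inj₂ (inj₂ g))) = proj₂ (grey-bound g) , proj₁ (grey-bound g)

  adj-sym : ∀ {p q} → Adj p q → Adj q p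
  adj-sym (inj₁ b) = inj₂ (inj₁ b)
  adj-sym (inj₂ (inj₁ b)) = inj₁ b
  adj-sym (inj₂ (inj₂ (inj₁ g))) = inj₂ (inj₂ (inj₂ g))
  adj-sym (inj₂ (inj₂ (inj₂ g))) = inj₂ (inj₂ (inj₁ g))

  twin-adj : ∀ p → p < N → Adj p (twin p)
  twin-adj p p< with parity p
  ... | k , inj₁ refl = inj₁ (k , half-bound k n p< , refl , twin-even k)
  ... | k , inj₂ refl = inj₂ (inj₁ (k , half-bound k n (<-trans (2k<2k+1 k) p<) , twin-odd k , refl))

  greyMate : ℕ → ℕ
  greyMate v = τ (twin (σ v))

  σ-greyMate : ∀ v → v < N → σ (greyMate v) ≡ twin (σ v)
  σ-greyMate v v< = σ∘τ _ (twin-bound n _ (σ-bound v v<))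

  greyMate-bound : ∀ v → v < N → greyMate v < N
  greyMate-bound v v< = τ-bound _ (twin-bound n _ (σ-bound v v<))

  twin-grey : ∀ {i j} → i < j → j < N → σ i < N → σ j ≡ twin (σ i) → GreyEdge i j
  twin-grey {i} i<j j< σi< e with parity (σ i)
  ... | k , inj₁ σi≡ = i<j , j< , k , half-bound k n (subst (_< N) σi≡ σi<) ,
          inj₁ (σi≡ , trans e (trans (cong twin σi≡) (twin-even k)))
  ... | k , inj₂ σi≡ = i<j , j< , k , half-bound k n (<-trans (2k<2k+1 k) (subst (_< N) σi≡ σi<)) ,
          inj₂ (σi≡ , trans e (trans (cong twin σi≡) (twin-odd k)))

  greyMate-adj : ∀ v → v < N → Adj v (greyMate v)
  greyMate-adj v v< with <-cmp v (greyMate v)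
  ... | tri< v<m _ _ =
    inj₂ (inj₂ (inj₁ (twin-grey v<m (greyMate-bound v v<) (σ-bound v v<) (σ-greyMate v v<))))
  ... | tri≈ _ e _ = ⊥-elim (twin-irreflexive (σ v) (trans (sym (σ-greyMate v v<)) (cong σ (sym e))))
  ... | tri> _ _ m<v =
    inj₂ (inj₂ (inj₂ (twin-grey m<v v< (σ-bound _ (greyMate-bound v v<))
      (trans (sym (twin-involutive (σ v))) (cong twin (sym (σ-greyMate v v<)))))))

  -- Deciding the relations of the graph; abstract keeps the large decision
  -- procedures from being unfolded during type checking.

  blackEdge? : ∀ p q → Dec (BlackEdge p q)
  blackEdge? p q = boundedΣ? (λ i → (i ≤? n) ×-dec (p ≟ 2 * i) ×-dec (q ≟ 2 * i + 1)) (suc n)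
                     (λ { (i≤n , _) → s≤s i≤n })

  greyEdge? : ∀ i j → Dec (GreyEdge i j)
  greyEdge? i j = (i <? j) ×-dec (j <? N) ×-dec
    boundedΣ? (λ k → (k ≤? n) ×-dec
                 (((σ i ≟ 2 * k) ×-dec (σ j ≟ 2 * k + 1)) ⊎-dec ((σ i ≟ 2 * k + 1) ×-dec (σ j ≟ 2 * k))))
              (suc n) (λ { (k≤n , _) → s≤s k≤n })

  adj? : ∀ p q → Dec (Adj p q)
  adj? p q = blackEdge? p q ⊎-dec blackEdge? q p ⊎-dec greyEdge? p q ⊎-dec greyEdge? q p

  abstract
    cyc? : ∀ p q → Dec (Cyc p q)
    cyc? = Reachability.reachable? adj? N (λ a → inj₂ (proj₂ (adj-bound a)))

  interleave? : ∀ i j i' j' → Dec (Interleave i j i' j')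
  interleave? i j i' j' =
    ¬? ((i ≟ i') ×-dec (j ≟ j')) ×-dec ((i' ≤? j) ×-dec (i ≤? j')) ×-dec
    ¬? ((i ≤? i') ×-dec (j' ≤? j)) ×-dec ¬? ((i' ≤? i) ×-dec (j ≤? j'))

  abstract
    cross? : ∀ p q → Dec (Cross p q)
    cross? p q =
      boundedΣ? (λ i → boundedΣ? (λ j → boundedΣ? (λ i' → boundedΣ? (λ j' →
        greyEdge? i j ×-dec greyEdge? i' j' ×-dec cyc? p i ×-dec cyc? q i' ×-dec interleave? i j i' j')
        N (λ h → proj₂ (grey-bound (proj₁ (proj₂ h)))))
        N (λ { (_ , h) → proj₁ (grey-bound (proj₁ (proj₂ h))) }))
        N (λ { (_ , _ , h) → proj₂ (grey-bound (proj₁ h)) }))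
        N (λ { (_ , _ , _ , h) → proj₁ (grey-bound (proj₁ h)) })

  cyc-sym : ∀ {p q} → Cyc p q → Cyc q p
  cyc-sym = reverse adj-sym

  cyc-bound : ∀ {x y} → Cyc x y → y ≡ x ⊎ y < N
  cyc-bound ε = inj₁ refl
  cyc-bound (a ◅ as) with cyc-bound as
  ... | inj₁ refl = inj₂ (proj₂ (adj-bound a))
  ... | inj₂ y< = inj₂ y<

  step-bound : ∀ {x y} → Step x y → y ≡ x ⊎ y < N
  step-bound (inj₁ c) = cyc-bound c
  step-bound (inj₂ (_ , _ , i' , _ , _ , g₂ , _ , c₂ , _)) with cyc-bound (cyc-sym c₂)
  ... | inj₁ refl = inj₂ (proj₁ (grey-bound g₂))
  ... | inj₂ y< = inj₂ y<

  step? : ∀ p q → Dec (Step p q)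
  step? p q = cyc? p q ⊎-dec cross? p q

  abstract
    comp? : ∀ p q → Dec (Comp p q)
    comp? = Reachability.reachable? step? N step-bound

  step-sym : ∀ {p q} → Step p q → Step q p
  step-sym (inj₁ c) = inj₁ (cyc-sym c)
  step-sym (inj₂ (i , j , i' , j' , g₁ , g₂ , c₁ , c₂ , il)) =
    inj₂ (i' , j' , i , j , g₂ , g₁ , c₂ , c₁ , interleave-sym il)

  comp-sym : ∀ {p q} → Comp p q → Comp q p
  comp-sym = reverse step-sym

  comp-bound : ∀ {x y} → Comp x y → x < N → y < N
  comp-bound ε x< = x<
  comp-bound (s ◅ ss) x< with step-bound s
  ... | inj₁ refl = comp-bound ss x<
  ... | inj₂ w< = comp-bound ss w<

  cycC : ∀ {p q} → Cyc p q → Comp p q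
  cycC c = inj₁ c ◅ ε

  adjC : ∀ {p q} → Adj p q → Comp p q
  adjC a = cycC (a ◅ ε)

  greyC : ∀ {s t} → GreyEdge s t → Comp s t
  greyC g = adjC (inj₂ (inj₂ (inj₁ g)))

  crossC : ∀ {s t c d} → GreyEdge s t → GreyEdge c d → Interleave s t c d → Comp s c
  crossC g₁ g₂ il = inj₂ (_ , _ , _ , _ , g₁ , g₂ , ε , ε , il) ◅ ε

  module Extent (x : ℕ) (x< : x < N) where

    InComp : ℕ → Set
    InComp v = Comp x v

    abstract
      inComp? : ∀ v → Dec (InComp v)
      inComp? v = comp? x v

    -- Comp is symmetric, so the complement of the component is closed as well
    outside-closed : ∀ {u w} → ¬ InComp u → Comp u w → ¬ InComp w
    outside-closed ¬Mu c Mw = ¬Mu (Mw ◅◅ comp-sym c)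

    abstract
      lo : ℕ
      lo = proj₁ (Search.least inComp? x ε)

      lo-inComp : InComp lo
      lo-inComp = proj₁ (proj₂ (Search.least inComp? x ε))

      lo-least : ∀ v → v < lo → ¬ InComp v
      lo-least = proj₂ (proj₂ (Search.least inComp? x ε))

      hi : ℕ
      hi = proj₁ (Search.greatest inComp? N x ε x<)

      hi-inComp : InComp hi
      hi-inComp = proj₁ (proj₂ (Search.greatest inComp? N x ε x<))

      hi-greatest : ∀ v → hi < v → v < N → ¬ InComp v
      hi-greatest = proj₂ (proj₂ (proj₂ (Search.greatest inComp? N x ε x<)))

    lo≤ : ∀ {v} → InComp v → lo ≤ v
    lo≤ {v} Mv with lo ≤? v
    ... | yes lo≤v = lo≤v
    ... | no lo≰v = ⊥-elim (lo-least v (≰⇒> lo≰v) Mv)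

    ≤hi : ∀ {v} → InComp v → v ≤ hi
    ≤hi {v} Mv with v ≤? hi
    ... | yes v≤hi = v≤hi
    ... | no v≰hi = ⊥-elim (hi-greatest v (≰⇒> v≰hi) (comp-bound Mv x<) Mv)

    Span : ℕ → Set
    Span v = lo ≤ v × v ≤ hi

    span? : ∀ v → Dec (Span v)
    span? v = (lo ≤? v) ×-dec (v ≤? hi)

    inComp⇒span : ∀ {v} → InComp v → Span v
    inComp⇒span Mv = lo≤ Mv , ≤hi Mv

    strictly-inside : ∀ {v} → Span v → ¬ InComp v → lo < v × v < hi
    strictly-inside (lo≤v , v≤hi) ¬Mv =
      ≤∧≢⇒< lo≤v (λ e → ¬Mv (subst InComp e lo-inComp)) ,
      ≤∧≢⇒< v≤hi (λ e → ¬Mv (subst InComp (sym e) hi-inComp))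

    Covered : ℕ → Set
    Covered v = Σ ℕ λ s → Σ ℕ λ t → (InComp s × GreyEdge s t) × s < v × v < t

    abstract
      covered? : ∀ v → Dec (Covered v)
      covered? v =
        boundedΣ? (λ s → boundedΣ? (λ t → (inComp? s ×-dec greyEdge? s t) ×-dec (s <? v) ×-dec (v <? t))
          N (λ h → proj₂ (grey-bound (proj₂ (proj₁ h)))))
          N (λ { (_ , h) → proj₁ (grey-bound (proj₂ (proj₁ h))) })

    -- An uncovered position v outside the component separates it: a path of
    -- the component starting left of v stays left of v (black edges join
    -- neighbours, and a grey edge jumping over v would cover v).
    module Separation (v : ℕ) (¬Mv : ¬ InComp v) (¬cov : ¬ Covered v) where

      adj-left : ∀ {u w} → InComp u → Adj u w → u < v → w < v
      adj-left {u} {w} Mu a u<v with <-cmp w v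
      ... | tri< w<v _ _ = w<v
      ... | tri≈ _ refl _ = ⊥-elim (¬Mv (Mu ◅◅ adjC a))
      ... | tri> _ _ v<w = ⊥-elim (jumps a)
        where
        jumps : Adj u w → ⊥
        jumps (inj₁ b) = <⇒≱ u<v (≤-pred (subst (v <_) (black-suc b) v<w))
        jumps (inj₂ (inj₁ b)) = <-asym (<-trans u<v v<w) (subst (w <_) (sym (black-suc b)) ≤-refl)
        jumps (inj₂ (inj₂ (inj₁ g))) = ¬cov (u , w , (Mu , g) , u<v , v<w)
        jumps (inj₂ (inj₂ (inj₂ g))) = <-asym (<-trans u<v v<w) (proj₁ g)

      cyc-left : ∀ {u w} → InComp u → Cyc u w → u < v → w < v
      cyc-left Mu ε u<v = u<v
      cyc-left Mu (a ◅ as) u<v = cyc-left (Mu ◅◅ adjC a) as (adj-left Mu a u<v)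

      cross-left : ∀ {u w} → InComp u → Cross u w → u < v → w < v
      cross-left {u} {w} Mu cr@(i , j , i' , j' , g₁ , g₂ , c₁ , c₂ , il) u<v =
        cyc-left Mi' (cyc-sym c₂) i'<v
        where
        Mi' : InComp i'
        Mi' = Mu ◅◅ (inj₂ cr ◅ cycC c₂)
        j<v : j < v
        j<v = adj-left (Mu ◅◅ cycC c₁) (inj₂ (inj₂ (inj₁ g₁))) (cyc-left Mu c₁ u<v)
        -- i' ≤ j since the two grey edges interleave
        i'<v : i' < v
        i'<v = ≤-<-trans (proj₁ (proj₁ (proj₂ il))) j<v

      comp-left : ∀ {u w} → InComp u → Comp u w → u < v → w < v
      comp-left Mu ε u<v = u<v
      comp-left Mu (inj₁ c ◅ ss) u<v = comp-left (Mu ◅◅ cycC c) ss (cyc-left Mu c u<v)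
      comp-left Mu (inj₂ cr ◅ ss) u<v = comp-left (Mu ◅◅ (inj₂ cr ◅ ε)) ss (cross-left Mu cr u<v)

    cover : ∀ {v} → lo < v → v < hi → ¬ InComp v → Covered v
    cover {v} lo<v v<hi ¬Mv with covered? v
    ... | yes cov = cov
    ... | no ¬cov = ⊥-elim (<-asym v<hi
            (Separation.comp-left v ¬Mv ¬cov lo-inComp (comp-sym lo-inComp ◅◅ hi-inComp) lo<v))

    -- A foreign position u strictly under a grey edge (s , t) of the
    -- component reaches only positions strictly under that edge: leaving
    -- would require an edge interleaving (s , t), putting u in the component.
    module Confinement (s t : ℕ) (Ms : InComp s) (gst : GreyEdge s t) where

      Mt : InComp t
      Mt = Ms ◅◅ greyC gst

      adj-inside : ∀ {u w} → ¬ InComp u → s < u → u < t → Adj u w → s < w × w < t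
      adj-inside {u} {w} ¬Mu s<u u<t a = inside a
        where
        ¬Mw : ¬ InComp w
        ¬Mw = outside-closed ¬Mu (adjC a)
        inside : Adj u w → s < w × w < t
        inside (inj₁ b) =
          subst (s <_) (sym (black-suc b)) (<-trans s<u (n<1+n u)) ,
          ≤∧≢⇒< (subst (_≤ t) (sym (black-suc b)) u<t) (λ e → ¬Mw (subst InComp (sym e) Mt))
        inside (inj₂ (inj₁ b)) =
          ≤∧≢⇒< (≤-pred (subst (s <_) (black-suc b) s<u)) (λ e → ¬Mw (subst InComp e Ms)) ,
          <-trans (n<1+n w) (subst (_< t) (black-suc b) u<t)
        inside (inj₂ (inj₂ (inj₁ g))) = <-trans s<u (proj₁ g) , w<t
          where
          w<t : w < t
          w<t with <-cmp w t
          ... | tri< w<t _ _ = w<t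
          ... | tri≈ _ refl _ = ⊥-elim (¬Mw Mt)
          ... | tri> _ _ t<w = ⊥-elim (¬Mu (Ms ◅◅ crossC gst g (interleave-left s<u u<t t<w)))
        inside (inj₂ (inj₂ (inj₂ g))) = s<w , <-trans (proj₁ g) u<t
          where
          s<w : s < w
          s<w with <-cmp s w
          ... | tri< s<w _ _ = s<w
          ... | tri≈ _ refl _ = ⊥-elim (¬Mw Ms)
          ... | tri> _ _ w<s = ⊥-elim (¬Mw (Ms ◅◅ crossC gst g (interleave-right w<s s<u u<t)))

      cyc-inside : ∀ {u w} → ¬ InComp u → s < u → u < t → Cyc u w → s < w × w < t
      cyc-inside ¬Mu s<u u<t ε = s<u , u<t
      cyc-inside ¬Mu s<u u<t (a ◅ as) with adj-inside ¬Mu s<u u<t a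
      ... | s<w , w<t = cyc-inside (outside-closed ¬Mu (adjC a)) s<w w<t as

      cross-inside : ∀ {u w} → ¬ InComp u → s < u → u < t → Cross u w → s < w × w < t
      cross-inside {u} ¬Mu s<u u<t cr@(i , j , i' , j' , g₁ , g₂ , c₁ , c₂ , il@(_ , (i'≤j , i≤j') , _ , ⊉)) =
        cyc-inside ¬Mi' s<i' i'<t (cyc-sym c₂)
        where
        ¬Mi : ¬ InComp i
        ¬Mi = outside-closed ¬Mu (cycC c₁)
        ¬Mi' : ¬ InComp i'
        ¬Mi' = outside-closed ¬Mu (inj₂ cr ◅ cycC c₂)
        i-inside : s < i × i < t
        i-inside = cyc-inside ¬Mu s<u u<t c₁
        j<t : j < t
        j<t = proj₂ (adj-inside ¬Mi (proj₁ i-inside) (proj₂ i-inside) (inj₂ (inj₂ (inj₁ g₁))))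
        i'<t : i' < t
        i'<t = ≤-<-trans i'≤j j<t
        -- if i' < s, the edge (i' , j') crosses (s , t) or contains (i , j)
        s<i' : s < i'
        s<i' with <-cmp s i'
        ... | tri< s<i' _ _ = s<i'
        ... | tri≈ _ refl _ = ⊥-elim (¬Mi' Ms)
        ... | tri> _ _ i'<s with <-cmp j' t
        ...   | tri< j'<t _ _ = ⊥-elim (¬Mi' (Ms ◅◅ crossC gst g₂
                                 (interleave-right i'<s (<-≤-trans (proj₁ i-inside) i≤j') j'<t)))
        ...   | tri≈ _ refl _ = ⊥-elim (outside-closed ¬Mi' (greyC g₂) Mt)
        ...   | tri> _ _ t<j' = ⊥-elim (⊉ (<⇒≤ (<-trans i'<s (proj₁ i-inside)) , <⇒≤ (<-trans j<t t<j')))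

      comp-inside : ∀ {u w} → ¬ InComp u → s < u → u < t → Comp u w → s < w × w < t
      comp-inside ¬Mu s<u u<t ε = s<u , u<t
      comp-inside ¬Mu s<u u<t (inj₁ c ◅ ss) with cyc-inside ¬Mu s<u u<t c
      ... | s<w , w<t = comp-inside (outside-closed ¬Mu (cycC c)) s<w w<t ss
      comp-inside ¬Mu s<u u<t (inj₂ cr ◅ ss) with cross-inside ¬Mu s<u u<t cr
      ... | s<w , w<t = comp-inside (outside-closed ¬Mu (inj₂ cr ◅ ε)) s<w w<t ss

    Enclosed : ℕ → Set
    Enclosed v = Σ ℕ λ s → Σ ℕ λ t → InComp s × InComp t × (∀ {w} → Comp v w → s < w × w < t)

    enclosed : ∀ {v} → Span v → ¬ InComp v → Enclosed v
    enclosed {v} sv ¬Mv with cover (proj₁ (strictly-inside sv ¬Mv)) (proj₂ (strictly-inside sv ¬Mv)) ¬Mv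
    ... | s , t , (Ms , gst) , s<v , v<t =
      s , t , Ms , Confinement.Mt s t Ms gst , Confinement.comp-inside s t Ms gst ¬Mv s<v v<t

    span-closed : ∀ {v w} → Span v → Comp v w → Span w
    span-closed {v} sv c with inComp? v
    ... | yes Mv = inComp⇒span (Mv ◅◅ c)
    ... | no ¬Mv with enclosed sv ¬Mv
    ...   | s , t , Ms , Mt , inside =
      ≤-trans (lo≤ Ms) (<⇒≤ (proj₁ (inside c))) , ≤-trans (<⇒≤ (proj₂ (inside c))) (≤hi Mt)

    SpanLabel : ℕ → Set
    SpanLabel l = Span (τ l)

    spanLabel? : ∀ l → Dec (SpanLabel l)
    spanLabel? l = span? (τ l)

    label-of-span : ∀ {p} → p < N → Span p → SpanLabel (σ p)
    label-of-span p< sp = subst Span (sym (τ∘σ _ p<)) sp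

    -- closed under twins, since grey edges stay inside the span
    spanLabel-twin : ∀ l → l < N → SpanLabel l → SpanLabel (twin l)
    spanLabel-twin l l< sl =
      subst Span (cong (τ ∘ twin) (σ∘τ l l<)) (span-closed sl (adjC (greyMate-adj (τ l) (τ-bound l l<))))

    spanLabel-entryTwin : ∀ l → 1 ≤ l → l ≤ 2 * n → SpanLabel l → τ l ≢ lo → τ l ≢ hi →
      SpanLabel (entryTwin l)
    spanLabel-entryTwin l 1≤l l≤ (lo≤p , p≤hi) p≢lo p≢hi =
      subst Span (sym (RelabellingProperties.τ-entryTwin R l 1≤l l≤)) span-entryTwin
      where
      lo<p : lo < τ l
      lo<p = ≤∧≢⇒< lo≤p (p≢lo ∘ sym)
      span-entryTwin : Span (entryTwin (τ l))
      span-entryTwin with entryTwin-cases (τ l) (≤-<-trans z≤n lo<p)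
      ... | inj₁ e = subst Span (sym e) (≤-trans lo≤p (n≤1+n _) , ≤∧≢⇒< p≤hi p≢hi)
      ... | inj₂ e = ≤-pred (subst (lo <_) (sym e) lo<p) , ≤-trans (subst (entryTwin (τ l) ≤_) e (n≤1+n _)) p≤hi

    Endpoint : ℕ → Set
    Endpoint p = p ≡ lo ⊎ p ≡ hi

    rightBoundary : ∀ b → suc b < N → SpanLabel b → ¬ SpanLabel (suc b) → Endpoint (τ b) × 1 ≤ b
    rightBoundary b sb< in-b out-sb with next-position n b sb<
    ... | inj₁ e = ⊥-elim (out-sb (subst SpanLabel (sym e) (spanLabel-twin b (<-trans (n<1+n b) sb<) in-b)))
    ... | inj₂ (1≤b , b≤ , e) with τ b ≟ lo | τ b ≟ hi
    ...   | yes atLo | _ = inj₁ atLo , 1≤b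
    ...   | no _ | yes atHi = inj₂ atHi , 1≤b
    ...   | no ¬lo | no ¬hi = ⊥-elim (out-sb (subst SpanLabel (sym e) (spanLabel-entryTwin b 1≤b b≤ in-b ¬lo ¬hi)))

    leftBoundary : ∀ b → suc b < N → ¬ SpanLabel b → SpanLabel (suc b) → Endpoint (τ (suc b))
    leftBoundary b sb< out-b in-sb with previous-position n b sb<
    ... | inj₁ e = ⊥-elim (out-b (subst SpanLabel (sym e) (spanLabel-twin (suc b) sb< in-sb)))
    ... | inj₂ (1≤ , sb≤ , e) with τ (suc b) ≟ lo | τ (suc b) ≟ hi
    ...   | yes atLo | _ = inj₁ atLo
    ...   | no _ | yes atHi = inj₂ atHi
    ...   | no ¬lo | no ¬hi = ⊥-elim (out-b (subst SpanLabel (sym e) (spanLabel-entryTwin (suc b) 1≤ sb≤ in-sb ¬lo ¬hi)))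

    -- a label is never isolated, as its twin is a neighbour
    no-isolated-label : ∀ b → suc (suc b) < N → ¬ SpanLabel b → SpanLabel (suc b) → ¬ SpanLabel (suc (suc b)) → ⊥
    no-isolated-label b ssb< out-b in-sb out-ssb with twin-cases (suc b)
    ... | inj₁ e = out-ssb (subst SpanLabel e (spanLabel-twin (suc b) (<-trans (n<1+n _) ssb<) in-sb))
    ... | inj₂ e = out-b (subst SpanLabel (suc-injective e) (spanLabel-twin (suc b) (<-trans (n<1+n _) ssb<) in-sb))

    endpoint-beside-zero : SpanLabel 0 → ∀ {y} → y < N → Endpoint (τ y) → y ≡ 0 ⊎ τ y ≡ hi
    endpoint-beside-zero (lo≤τ0 , _) y< (inj₁ e) =
      inj₁ (τ-injective y< (≤-<-trans z≤n y<) (trans e (trans lo≡0 (sym τ-first))))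
      where
      lo≡0 : lo ≡ 0
      lo≡0 = n≤0⇒n≡0 (subst (lo ≤_) τ-first lo≤τ0)
    endpoint-beside-zero _ _ (inj₂ e) = inj₂ e

    -- Two ends of the span, one ending and one starting a gap in the labels,
    -- are impossible when label 0 is in the span: both would be hi.
    gap-with-zero : SpanLabel 0 → ∀ {b₁ b₂} → b₁ ≤ b₂ → suc b₂ < N → 1 ≤ b₁ →
      Endpoint (τ b₁) → Endpoint (τ (suc b₂)) → ⊥
    gap-with-zero in₀ {b₁} {b₂} b₁≤b₂ sb₂< 1≤b₁ end₁ end₂ =
      both-high (endpoint-beside-zero in₀ b₁< end₁) (endpoint-beside-zero in₀ sb₂< end₂)
      where
      b₁< : b₁ < N
      b₁< = ≤-<-trans b₁≤b₂ (<-trans (n<1+n b₂) sb₂<)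
      both-high : b₁ ≡ 0 ⊎ τ b₁ ≡ hi → suc b₂ ≡ 0 ⊎ τ (suc b₂) ≡ hi → ⊥
      both-high (inj₁ b₁≡0) _ = <⇒≢ 1≤b₁ (sym b₁≡0)
      both-high (inj₂ _) (inj₁ ())
      both-high (inj₂ hi₁) (inj₂ hi₂) = <⇒≢ (s≤s b₁≤b₂) (τ-injective b₁< sb₂< (trans hi₁ (sym hi₂)))

    -- When label 0 is outside the span, the labels also enter the span at
    -- some b₀+1 ≤ b₁, giving three ends of the span; two of them coincide.
    gap-without-zero : ¬ SpanLabel 0 → ∀ {b₁ b₂} → b₁ ≤ b₂ → suc b₂ < N →
      SpanLabel b₁ → ¬ SpanLabel (suc b₁) → 1 ≤ b₁ → Endpoint (τ b₁) → Endpoint (τ (suc b₂)) → ⊥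
    gap-without-zero out₀ {b₁} {b₂} b₁≤b₂ sb₂< in₁ out₁ 1≤b₁ end₁ end₂ =
      entered (firstEntry spanLabel? 0 b₁ out₀ in₁ 1≤b₁)
      where
      sb₁< : suc b₁ < N
      sb₁< = ≤-<-trans (s≤s b₁≤b₂) sb₂<
      b₁< : b₁ < N
      b₁< = <-trans (n<1+n b₁) sb₁<
      entered : (Σ ℕ λ b → 0 ≤ b × b < b₁ × ¬ SpanLabel b × SpanLabel (suc b)) → ⊥
      entered (b₀ , _ , b₀<b₁ , out-b₀ , in-sb₀) =
        coincide (pigeonhole₃ end₁ end₂ (leftBoundary b₀ sb₀< out-b₀ in-sb₀))
        where
        sb₀< : suc b₀ < N
        sb₀< = ≤-<-trans b₀<b₁ b₁<
        coincide : τ b₁ ≡ τ (suc b₂) ⊎ τ b₁ ≡ τ (suc b₀) ⊎ τ (suc b₂) ≡ τ (suc b₀) → ⊥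
        coincide (inj₁ e) = <⇒≢ (s≤s b₁≤b₂) (τ-injective b₁< sb₂< e)
        coincide (inj₂ (inj₁ e)) =
          no-isolated-label b₀ (subst (λ z → suc z < N) b₁≡ sb₁<) out-b₀ in-sb₀ (subst (¬_ ∘ SpanLabel ∘ suc) b₁≡ out₁)
          where
          b₁≡ : b₁ ≡ suc b₀
          b₁≡ = τ-injective b₁< sb₀< e
        coincide (inj₂ (inj₂ e)) =
          <⇒≢ (s≤s (<-≤-trans b₀<b₁ b₁≤b₂)) (sym (τ-injective sb₂< sb₀< e))

    no-gap : ∀ b₁ b₂ → b₁ ≤ b₂ → suc b₂ < N →
      SpanLabel b₁ → ¬ SpanLabel (suc b₁) → ¬ SpanLabel b₂ → SpanLabel (suc b₂) → ⊥
    no-gap b₁ b₂ b₁≤b₂ sb₂< in₁ out₁ out₂ in₂ = split (spanLabel? 0)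
      where
      right : Endpoint (τ b₁) × 1 ≤ b₁
      right = rightBoundary b₁ (≤-<-trans (s≤s b₁≤b₂) sb₂<) in₁ out₁
      end₂ : Endpoint (τ (suc b₂))
      end₂ = leftBoundary b₂ sb₂< out₂ in₂
      split : Dec (SpanLabel 0) → ⊥
      split (yes in₀) = gap-with-zero in₀ b₁≤b₂ sb₂< (proj₂ right) (proj₁ right) end₂
      split (no out₀) = gap-without-zero out₀ b₁≤b₂ sb₂< in₁ out₁ (proj₂ right) (proj₁ right) end₂

    spanLabels-convex : ∀ l₁ l₂ l₃ → l₁ < l₂ → l₂ < l₃ → l₃ < N →
      SpanLabel l₁ → SpanLabel l₃ → SpanLabel l₂
    spanLabels-convex l₁ l₂ l₃ l₁<l₂ l₂<l₃ l₃<N in₁ in₃ with spanLabel? l₂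
    ... | yes in₂ = in₂
    ... | no out₂ with Search.firstExit spanLabel? l₁ l₂ in₁ out₂ l₁<l₂ | firstEntry spanLabel? l₂ l₃ out₂ in₃ l₂<l₃
    ...   | b₁ , _ , b₁<l₂ , in-b₁ , out-sb₁ | b₂ , l₂≤b₂ , b₂<l₃ , out-b₂ , in-sb₂ =
      ⊥-elim (no-gap b₁ b₂ (≤-trans (<⇒≤ b₁<l₂) l₂≤b₂) (≤-<-trans b₂<l₃ l₃<N) in-b₁ out-sb₁ out-b₂ in-sb₂)

    twin-x< : twin x < N
    twin-x< = twin-bound n x x<

    span-twin-x : Span (twin x)
    span-twin-x = inComp⇒span (adjC (twin-adj x x<))

    between : ∀ {l} → σ x < l → l < σ (twin x) → SpanLabel l
    between x<l l<tx = spanLabels-convex _ _ _ x<l l<tx (σ-bound _ twin-x<)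
                         (label-of-span x< (inComp⇒span ε)) (label-of-span twin-x< span-twin-x)

    crossing-in-span : ∀ u → u < N → Interleave (σ x) (σ (twin x)) (σ u) (σ (twin u)) → Span u
    crossing-in-span u u< il with σ x ≟ σ u | σ u ≟ σ (twin x) | σ x ≟ σ (twin u)
    ... | yes e | _ | _ = subst Span (σ-injective x< u< e) (inComp⇒span ε)
    ... | no _ | yes e | _ = subst Span (σ-injective twin-x< u< (sym e)) span-twin-x
    ... | no _ | no _ | yes e =
      subst Span (trans (cong twin (σ-injective x< (twin-bound n u u<) e)) (twin-involutive u)) span-twin-x
    ... | no a≢a' | no a'≢b | no a≢b' with interleave-cases il a≢a' a'≢b a≢b'
    ...   | inj₁ (a<a' , a'<b , _) =
      subst Span (τ∘σ u u<) (between a<a' a'<b)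
    ...   | inj₂ (_ , a<b' , b'<b) =
      subst Span (twin-involutive u)
        (span-closed (subst Span (τ∘σ _ (twin-bound n u u<)) (between a<b' b'<b))
                     (adjC (twin-adj (twin u) (twin-bound n u u<))))


  -- Otherwise each would lie in the span of the other's
  -- component, each component would be enclosed by the other, and the
  -- enclosing positions s , s' would satisfy s < s' < s.
  crossing-black-edges : ∀ u u' → u < N → u' < N →
    Interleave (σ u) (σ (twin u)) (σ u') (σ (twin u')) → Comp u u'
  crossing-black-edges u u' u< u'< il with comp? u u'
  ... | yes c = c
  ... | no ¬c
    with Extent.enclosed u u< (Extent.crossing-in-span u u< u' u'< il) ¬c
       | Extent.enclosed u' u'< (Extent.crossing-in-span u' u'< u u< (interleave-sym il)) (¬c ∘ comp-sym)
  ...   | s , _ , Ms , _ , inside | s' , _ , Ms' , _ , inside' =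
    ⊥-elim (<-asym (proj₁ (inside' Ms)) (proj₁ (inside Ms')))

module Transfer {n : ℕ} (R : Relabelling n) where
  open Relabelling R
  open Graph n σ
  open Component R using (black-bound; black-twin; grey-bound; grey-twin; cyc-sym)
  module Dual = Component (dual R)
  module Target = Graph n τ

  black↦grey : ∀ {a b} → BlackEdge a b → Target.Adj (σ a) (σ b)
  black↦grey {a} {b} bl@(i , i≤n , e₁ , e₂) with black-bound bl | <-cmp (σ a) (σ b)
  ... | a< , b< | tri< lt _ _ =
    inj₂ (inj₂ (inj₁ (lt , σ-bound b b< , i , i≤n , inj₁ (trans (τ∘σ a a<) e₁ , trans (τ∘σ b b<) e₂))))
  ... | a< , b< | tri≈ _ eq _ =
    ⊥-elim (twin-irreflexive a (trans (sym (black-twin bl)) (sym (Component.σ-injective R a< b< eq))))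
  ... | a< , b< | tri> _ _ gt =
    inj₂ (inj₂ (inj₂ (gt , σ-bound a a< , i , i≤n , inj₂ (trans (τ∘σ b b<) e₂ , trans (τ∘σ a a<) e₁))))

  grey↦black : ∀ {a b} → GreyEdge a b → Target.Adj (σ a) (σ b)
  grey↦black (_ , _ , k , k≤n , inj₁ (e₁ , e₂)) = inj₁ (k , k≤n , e₁ , e₂)
  grey↦black (_ , _ , k , k≤n , inj₂ (e₁ , e₂)) = inj₂ (inj₁ (k , k≤n , e₂ , e₁))

  adj↦adj : ∀ {a b} → Adj a b → Target.Adj (σ a) (σ b)
  adj↦adj (inj₁ b) = black↦grey b
  adj↦adj (inj₂ (inj₁ b)) = Dual.adj-sym (black↦grey b)
  adj↦adj (inj₂ (inj₂ (inj₁ g))) = grey↦black g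
  adj↦adj (inj₂ (inj₂ (inj₂ g))) = Dual.adj-sym (grey↦black g)

  cyc↦cyc : ∀ {a b} → Cyc a b → Target.Cyc (σ a) (σ b)
  cyc↦cyc = gmap σ adj↦adj

  -- grey edges (i , j) and (i' , j') become black edges at σ i and σ i',
  -- whose label intervals under τ are (i , j) and (i' , j')
  cross↦comp : ∀ {p w} → Cross p w → Target.Comp (σ p) (σ w)
  cross↦comp (i , j , i' , j' , g₁ , g₂ , c₁ , c₂ , il) =
    Dual.cycC (cyc↦cyc c₁) ◅◅ (crossing ◅◅ Dual.cycC (cyc↦cyc (cyc-sym c₂)))
    where
    back : ∀ {a b} → GreyEdge a b → τ (σ a) ≡ a × τ (twin (σ a)) ≡ b
    back {a} {b} g = τ∘σ a (proj₁ (grey-bound g)) ,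
                     trans (cong τ (sym (grey-twin g))) (τ∘σ b (proj₂ (grey-bound g)))
    crossing : Target.Comp (σ i) (σ i')
    crossing = Dual.crossing-black-edges (σ i) (σ i') (σ-bound i (proj₁ (grey-bound g₁))) (σ-bound i' (proj₁ (grey-bound g₂)))
      (interleave-cong (sym (proj₁ (back g₁))) (sym (proj₂ (back g₁))) (sym (proj₁ (back g₂))) (sym (proj₂ (back g₂))) il)

  transfer : ∀ {p q} → Comp p q → Target.Comp (σ p) (σ q)
  transfer ε = ε
  transfer (inj₁ c ◅ ss) = Dual.cycC (cyc↦cyc c) ◅◅ transfer ss
  transfer (inj₂ cr ◅ ss) = cross↦comp cr ◅◅ transfer ss

-- position of the first (true) or second (false) slot of the entry with index i
entryPos : ℕ → Bool → ℕ
entryPos i true = suc (2 * i)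
entryPos i false = suc (suc (2 * i))

position-cases : ∀ n p → p < 2 * n + 2 →
  p ≡ 0 ⊎ p ≡ 2 * n + 1 ⊎ Σ ℕ λ i → i < n × Σ Bool λ b → p ≡ entryPos i b
position-cases n zero _ = inj₁ refl
position-cases n (suc m) p< with parity m
... | k , inj₁ refl with k ≟ n
...   | yes refl = inj₂ (inj₁ (sym (2k+1≡suc k)))
...   | no k≢n = inj₂ (inj₂ (k , ≤∧≢⇒< (half-bound k n (<-trans (n<1+n _) p<)) k≢n , true , refl))
position-cases n (suc m) p< | k , inj₂ refl =
  inj₂ (inj₂ (k , half-bound (suc k) n (subst (_< 2 * n + 2) (suc[2k+1]≡ k) p<) , false , cong suc (2k+1≡suc k)))

entryPos-bound : ∀ {n} a b → a < n → entryPos a b < 2 * n + 2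
entryPos-bound {n} a b a<n =
  ≤-<-trans (≤-trans (slot≤ b) (subst (_≤ 2 * n) (*-suc 2 a) (*-monoʳ-≤ 2 a<n)))
            (<-trans (2k<2k+1 n) (last<size n))
  where
  slot≤ : ∀ b → entryPos a b ≤ suc (suc (2 * a))
  slot≤ true = n≤1+n _
  slot≤ false = ≤-refl

entryTwin-entryPos : ∀ i b → entryTwin (entryPos i b) ≡ entryPos i (not b)
entryTwin-entryPos i true = cong suc (trans (twin-even i) (2k+1≡suc i))
entryTwin-entryPos i false = cong suc (trans (cong twin (sym (2k+1≡suc i))) (twin-odd i))

double/2 : ∀ i → (2 * i) / 2 ≡ i
double/2 i = trans (cong (_/ 2) (*-comm 2 i)) (m*n/n≡m i 2)

double%2 : ∀ i → (2 * i) % 2 ≡ 0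
double%2 i = trans (cong (_% 2) (*-comm 2 i)) (m*n%n≡0 i 2)

suc-double/2 : ∀ i → suc (2 * i) / 2 ≡ i
suc-double/2 i =
  trans (+-distrib-/ 1 (2 * i) {2} (subst (λ z → 1 % 2 + z < 2) (sym (double%2 i)) (s≤s (s≤s z≤n)))) (double/2 i)

suc-double%2 : ∀ i → suc (2 * i) % 2 ≡ 1
suc-double%2 i = trans (%-distribˡ-+ 1 (2 * i) 2) (cong (λ z → (1 + z) % 2) (double%2 i))

entryLabel-entryPos : ∀ {n} (ρ : SignedPerm n) f first →
  entryLabel ρ f first ≡ entryPos (toℕ (perm ρ ⟨$⟩ʳ f)) (first xor neg ρ f)
entryLabel-entryPos ρ f first = slot (toℕ (perm ρ ⟨$⟩ʳ f)) (neg ρ f) first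
  where
  slot : ∀ a s first →
    (if s then (if first then 2 * a + 2 else 2 * a + 1) else (if first then 2 * a + 1 else 2 * a + 2))
      ≡ entryPos a (first xor s)
  slot a true true = +-comm (2 * a) 2
  slot a true false = 2k+1≡suc a
  slot a false true = 2k+1≡suc a
  slot a false false = +-comm (2 * a) 2

prime-index : ∀ {n} (ρ : SignedPerm n) m i (i<n : i < n) → m / 2 ≡ i →
  prime ρ (suc m) ≡ entryLabel ρ (fromℕ< i<n) (m % 2 ≡ᵇ 0)
prime-index {n} ρ m i i<n e with m / 2 <? n
... | yes m/2<n = cong (λ f → entryLabel ρ f (m % 2 ≡ᵇ 0)) (fromℕ<-cong (m / 2) i e m/2<n i<n)
... | no m/2≮n = ⊥-elim (m/2≮n (subst (_< n) (sym e) i<n))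

prime-entryPos : ∀ {n} (ρ : SignedPerm n) i (i<n : i < n) b →
  prime ρ (entryPos i b) ≡ entryPos (toℕ (perm ρ ⟨$⟩ʳ fromℕ< i<n)) (b xor neg ρ (fromℕ< i<n))
prime-entryPos ρ i i<n true =
  trans (prime-index ρ (2 * i) i i<n (double/2 i))
    (trans (cong (entryLabel ρ (fromℕ< i<n) ∘ (_≡ᵇ 0)) (double%2 i)) (entryLabel-entryPos ρ _ true))
prime-entryPos ρ i i<n false =
  trans (prime-index ρ (suc (2 * i)) i i<n (suc-double/2 i))
    (trans (cong (entryLabel ρ (fromℕ< i<n) ∘ (_≡ᵇ 0)) (suc-double%2 i)) (entryLabel-entryPos ρ _ false))

prime-last : ∀ {n} (ρ : SignedPerm n) → prime ρ (2 * n + 1) ≡ 2 * n + 1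
prime-last {n} ρ = trans (cong (prime ρ) (2k+1≡suc n)) beyond
  where
  beyond : prime ρ (suc (2 * n)) ≡ 2 * n + 1
  beyond with (2 * n) / 2 <? n
  ... | yes n<n = ⊥-elim (<-irrefl refl (subst (_< n) (double/2 n) n<n))
  ... | no _ = refl

prime-bound : ∀ {n} (ρ : SignedPerm n) p → p < 2 * n + 2 → prime ρ p < 2 * n + 2
prime-bound {n} ρ p p< with position-cases n p p<
... | inj₁ refl = p<
... | inj₂ (inj₁ refl) = subst (_< 2 * n + 2) (sym (prime-last ρ)) p<
... | inj₂ (inj₂ (i , i<n , b , refl)) =
  subst (_< 2 * n + 2) (sym (prime-entryPos ρ i i<n b)) (entryPos-bound _ _ (toℕ<n _))

prime-entryTwin : ∀ {n} (ρ : SignedPerm n) p → 1 ≤ p → p ≤ 2 * n →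
  prime ρ (entryTwin p) ≡ entryTwin (prime ρ p)
prime-entryTwin {n} ρ p 1≤p p≤ with position-cases n p (≤-<-trans p≤ (<-trans (2k<2k+1 n) (last<size n)))
... | inj₁ refl = ⊥-elim (<-irrefl refl 1≤p)
... | inj₂ (inj₁ refl) = ⊥-elim (<-irrefl refl (subst (_≤ 2 * n) (2k+1≡suc n) p≤))
... | inj₂ (inj₂ (i , i<n , b , refl)) = begin
  prime ρ (entryTwin (entryPos i b))    ≡⟨ cong (prime ρ) (entryTwin-entryPos i b) ⟩
  prime ρ (entryPos i (not b))          ≡⟨ prime-entryPos ρ i i<n (not b) ⟩
  entryPos a (not b xor s)              ≡⟨ cong (entryPos a) (sym (not-distribˡ-xor b s)) ⟩
  entryPos a (not (b xor s))            ≡⟨ sym (entryTwin-entryPos a (b xor s)) ⟩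
  entryTwin (entryPos a (b xor s))      ≡⟨ cong entryTwin (sym (prime-entryPos ρ i i<n b)) ⟩
  entryTwin (prime ρ (entryPos i b))    ∎
  where
  open ≡-Reasoning
  a : ℕ
  a = toℕ (perm ρ ⟨$⟩ʳ fromℕ< i<n)
  s : Bool
  s = neg ρ (fromℕ< i<n)

xor-cancelʳ : ∀ b s → (b xor s) xor s ≡ b
xor-cancelʳ b s = trans (xor-assoc b s s) (trans (cong (b xor_) (xor-same s)) (xor-identityʳ b))

prime-inverse∘prime : ∀ {n} (ρ : SignedPerm n) p → p < 2 * n + 2 → prime (inverse ρ) (prime ρ p) ≡ p
prime-inverse∘prime {n} ρ p p< with position-cases n p p<
... | inj₁ refl = refl
... | inj₂ (inj₁ refl) = trans (cong (prime (inverse ρ)) (prime-last ρ)) (prime-last (inverse ρ))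
... | inj₂ (inj₂ (i , i<n , b , refl)) =
  trans (cong (prime (inverse ρ)) (prime-entryPos ρ i i<n b))
    (trans (prime-entryPos (inverse ρ) _ (toℕ<n x) (b xor neg ρ fi)) (cong₂ entryPos index sign))
  where
  P : Permutation′ n
  P = perm ρ
  fi : Fin n
  fi = fromℕ< i<n
  x : Fin n
  x = P ⟨$⟩ʳ fi
  back : P ⟨$⟩ˡ fromℕ< (toℕ<n x) ≡ fi
  back = trans (cong (P ⟨$⟩ˡ_) (fromℕ<-toℕ x (toℕ<n x))) (inverseˡ P)
  index : toℕ (flip P ⟨$⟩ʳ fromℕ< (toℕ<n x)) ≡ i
  index = trans (cong toℕ back) (toℕ-fromℕ< i<n)
  sign : (b xor neg ρ fi) xor neg (inverse ρ) (fromℕ< (toℕ<n x)) ≡ b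
  sign = trans (cong ((b xor neg ρ fi) xor_) (cong (neg ρ) back)) (xor-cancelʳ b _)

prime∘prime-inverse : ∀ {n} (ρ : SignedPerm n) l → l < 2 * n + 2 → prime ρ (prime (inverse ρ) l) ≡ l
prime∘prime-inverse {n} ρ l l< with position-cases n l l<
... | inj₁ refl = refl
... | inj₂ (inj₁ refl) = trans (cong (prime ρ) (prime-last (inverse ρ))) (prime-last ρ)
... | inj₂ (inj₂ (a , a<n , c , refl)) =
  trans (cong (prime ρ) (prime-entryPos (inverse ρ) a a<n c))
    (trans (prime-entryPos ρ _ (toℕ<n j) (c xor neg ρ j)) (cong₂ entryPos index sign))
  where
  P : Permutation′ n
  P = perm ρ
  j : Fin n
  j = P ⟨$⟩ˡ fromℕ< a<n
  back : fromℕ< (toℕ<n j) ≡ j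
  back = fromℕ<-toℕ j (toℕ<n j)
  index : toℕ (P ⟨$⟩ʳ fromℕ< (toℕ<n j)) ≡ a
  index = trans (cong toℕ (trans (cong (P ⟨$⟩ʳ_) back) (inverseʳ P))) (toℕ-fromℕ< a<n)
  sign : (c xor neg ρ j) xor neg ρ (fromℕ< (toℕ<n j)) ≡ c
  sign = trans (cong ((c xor neg ρ j) xor_) (cong (neg ρ) back)) (xor-cancelʳ c _)

primeRelabelling : ∀ {n} → SignedPerm n → Relabelling n
primeRelabelling π = record
  { σ = prime π ; τ = prime (inverse π)
  ; σ-bound = prime-bound π ; τ-bound = prime-bound (inverse π)
  ; τ∘σ = prime-inverse∘prime π ; σ∘τ = prime∘prime-inverse π
  ; σ-first = refl ; σ-last = prime-last π ; σ-entryTwin = prime-entryTwin π }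

lemma6 : (n : ℕ) (π : SignedPerm n) (p q : ℕ) →
         p < 2 * n + 2 → q < 2 * n + 2 →
         SameComponent π p q ⇔
           SameComponent (inverse π) (prime π p) (prime π q)
lemma6 n π p q p< q< = mk⇔ (Transfer.transfer R) backward
  where
  R : Relabelling n
  R = primeRelabelling π
  -- transfer back along the inverse relabelling and cancel prime (inverse π) ∘ prime π
  backward : SameComponent (inverse π) (prime π p) (prime π q) → SameComponent π p q
  backward c = subst₂ (SameComponent π) (prime-inverse∘prime π p p<) (prime-inverse∘prime π q q<)
                 (Transfer.transfer (dual R) c)
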